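{- Let $\mathbf{P}=(S,\mathcal{L})$ be the projective space of a vector space $V$ over a field of characteristic different from $2$, and let $\varkappa$ be a quasi-correlation of $\mathbf{P}$. Let $h_0$ be a hyperplane of $\mathbf{P}$ such that $h_0\not\subseteq\{a\in S : a\in\varkappa(a)\}$. Put $$\mathcal{H}=\{2a : a\in h_0\}\ \cup\ \{x+y : x\in S,\ y\in\varkappa(x)\}.$$ Then $\mathcal{H}$ is not a subspace of the Veronese space $\mathbf{V}_2(\mathbf{P})$.
   Context: The points of $\mathbf{P}$ are the $1$-dimensional subspaces $\langle v\rangle$ of $V$ and its lines are the sets of points contained in $2$-dimensional subspaces. A quasi-correlation $\varkappa$ of $\mathbf{P}$ is given by a nonzero reflexive sesquilinear form $\xi$ on $V$ (reflexive: $\xi(u,v)=0\iff\xi(v,u)=0$) via $\varkappa(\langle v\rangle)=\{\langle u\rangle : \xi(u,v)=0\}$. Multisets of size $2$ over $S$ are written $x+y$ ($x,y\in S$), with $2x=x+x$. The Veronese space $\mathbf{V}_2(\mathbf{P})$ has as points all $x+y$ ($x,y\in S$) and as lines all $x+L=\{x+y:y\in L\}$ ($x\in S$, $L\in\mathcal{L}$) and $2L=\{2y:y\in L\}$ ($L\in\mathcal{L}$). A subspace of a partial linear space is a set $X$ of points such that every line meeting $X$ in at least two points is contained in $X$. -}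

module Defs where

open import Level using (Level; _⊔_; suc)
open import Algebra.Bundles using (CommutativeRing)
open import Algebra.Module.Bundles using (Module)
open import Data.Product using (Σ; ∃; _×_; _,_; proj₁; proj₂)
open import Data.Sum using (_⊎_; inj₁; inj₂)
open import Relation.Nullary using (¬_)

record Field (c ℓ : Level) : Set (suc (c ⊔ ℓ)) where
  field
    commutativeRing : CommutativeRing c ℓ
  open CommutativeRing commutativeRing public
  field
    0≉1     : ¬ (0# ≈ 1#)
    inverse : ∀ x → ¬ (x ≈ 0#) → ∃ λ y → x * y ≈ 1#

CharNot2 : ∀ {c ℓ} → Field c ℓ → Set ℓ
CharNot2 F = ¬ (1# + 1# ≈ 0#)
  where open Field F

record IsFieldAutomorphism {c ℓ} (F : Field c ℓ) (σ : Field.Carrier F → Field.Carrier F)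
       : Set (c ⊔ ℓ) where
  open Field F
  field
    cong     : ∀ {x y} → x ≈ y → σ x ≈ σ y
    hom-+    : ∀ x y → σ (x + y) ≈ σ x + σ y
    hom-*    : ∀ x y → σ (x * y) ≈ σ x * σ y
    hom-1    : σ 1# ≈ 1#
    injective  : ∀ x y → σ x ≈ σ y → x ≈ y
    surjective : ∀ y → ∃ λ x → σ x ≈ y

module ProjectiveSpace {c ℓ m ℓm : Level} (F : Field c ℓ)
         (V : Module (Field.commutativeRing F) m ℓm) where
  open Field F
  open Module V

  -- points of P: nonzero vectors, representing ⟨v⟩
  Pt : Set (m ⊔ ℓm)
  Pt = Σ Carrierᴹ λ v → ¬ (v ≈ᴹ 0ᴹ)

  vec : Pt → Carrierᴹ
  vec = proj₁

  _≐_ : Pt → Pt → Set (c ⊔ ℓm)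
  p ≐ q = ∃ λ a → vec p ≈ᴹ a *ₗ vec q

  PLine : Set (c ⊔ m ⊔ ℓm)
  PLine = Σ (Pt × Pt) λ pq → ¬ (proj₁ pq ≐ proj₂ pq)

  _∈P_ : Pt → PLine → Set (c ⊔ ℓm)
  r ∈P ((p , q) , _) = ∃ λ a → ∃ λ b → vec r ≈ᴹ (a *ₗ vec p) +ᴹ (b *ₗ vec q)

  record IsReflexiveSesquilinear (ξ : Carrierᴹ → Carrierᴹ → Carrier)
         : Set (c ⊔ ℓ ⊔ m ⊔ ℓm) where
    field
      σ        : Carrier → Carrier
      σ-auto   : IsFieldAutomorphism F σ
      cong     : ∀ {u u' v v'} → u ≈ᴹ u' → v ≈ᴹ v' → ξ u v ≈ ξ u' v'
      +-left   : ∀ u u' v → ξ (u +ᴹ u') v ≈ ξ u v + ξ u' v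
      +-right  : ∀ u v v' → ξ u (v +ᴹ v') ≈ ξ u v + ξ u v'
      *-left   : ∀ a u v → ξ (a *ₗ u) v ≈ a * ξ u v
      *-right  : ∀ a u v → ξ u (a *ₗ v) ≈ σ a * ξ u v
      nonzero  : ∃ λ u → ∃ λ v → ¬ (ξ u v ≈ 0#)
      reflexive-l : ∀ u v → ξ u v ≈ 0# → ξ v u ≈ 0#

  -- quasi-correlation κ given by ξ : κ(⟨v⟩) = {⟨u⟩ : ξ(u,v) = 0}
  _∈κ[_]_ : Pt → (Carrierᴹ → Carrierᴹ → Carrier) → Pt → Set ℓ
  u ∈κ[ ξ ] v = ξ (vec u) (vec v) ≈ 0#

  -- 2-multisets of points: x + y is represented by (x , y)
  MPt : Set (m ⊔ ℓm)
  MPt = Pt × Pt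

  _≐ₘ_ : MPt → MPt → Set (c ⊔ ℓm)
  (x , y) ≐ₘ (x' , y') = ((x ≐ x') × (y ≐ y')) ⊎ ((x ≐ y') × (y ≐ x'))

  -- lines of the Veronese space V₂(P): x + L and 2L
  VLine : Set (c ⊔ m ⊔ ℓm)
  VLine = (Pt × PLine) ⊎ PLine

  _∈V_ : MPt → VLine → Set (c ⊔ m ⊔ ℓm)
  z ∈V inj₁ (x , L) = ∃ λ y → (y ∈P L) × (z ≐ₘ (x , y))
  z ∈V inj₂ L       = ∃ λ y → (y ∈P L) × (z ≐ₘ (y , y))

IsSubspace : ∀ {a e l r p} (Point : Set a) (_≃_ : Point → Point → Set e)
             (Line : Set l) (_∈_ : Point → Line → Set r)
             (X : Point → Set p) → Set (a ⊔ e ⊔ l ⊔ r ⊔ p)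
IsSubspace Point _≃_ Line _∈_ X =
  ∀ (L : Line) (x y : Point) → x ∈ L → y ∈ L → ¬ (x ≃ y) → X x → X y →
  ∀ (z : Point) → z ∈ L → X z

RespectsEq : ∀ {a e p} (Point : Set a) (_≃_ : Point → Point → Set e)
             (X : Point → Set p) → Set (a ⊔ e ⊔ p)
RespectsEq Point _≃_ X = ∀ x y → x ≃ y → X x → X y

module Hyperplanes {c ℓ m ℓm : Level} (F : Field c ℓ)
         (V : Module (Field.commutativeRing F) m ℓm) where
  open ProjectiveSpace F V

  record IsHyperplane {p} (h : Pt → Set p) : Set (suc p ⊔ c ⊔ m ⊔ ℓm) where
    field
      respects : RespectsEq Pt _≐_ h
      subspace : IsSubspace Pt _≐_ PLine _∈P_ h
      proper   : ∃ λ x → ¬ h x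
      maximal  : ∀ (Y : Pt → Set p) → RespectsEq Pt _≐_ Y →
                 IsSubspace Pt _≐_ PLine _∈P_ Y →
                 (∀ x → h x → Y x) →
                 (∀ x → Y x → h x) ⊎ (∀ x → Y x)

module Submission where

-- Pick a ∈ h₀ with ξ(a,a) ≠ 0 and any point d ∉ h₀; then d is not a
-- multiple of a.  The Gram–Schmidt step b = d − ξ(d,a) ξ(a,a)⁻¹ a gives a
-- vector with ξ(b,a) = 0 that is still not a multiple of a, so ⟨a⟩ and ⟨b⟩
-- span a line L of P.  The Veronese line a + L contains 2a ∈ H and
-- a + b ∈ H (as b ∈ κ(a)), but also a + c with c = b + a: here ⟨c⟩ ≠ ⟨a⟩
-- and ξ(c,a) = ξ(a,c) = ξ(a,a) ≠ 0, so a + c is neither a double point nor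
-- a pair of conjugate points, i.e. a + c ∉ H.

open import Defs
open import Level using (Level; _⊔_)
open import Algebra.Module.Bundles using (Module)
open import Data.Product using (∃; _×_; _,_; proj₁; proj₂)
open import Data.Sum using (_⊎_; inj₁; inj₂)
open import Relation.Nullary using (¬_)
import Algebra.Properties.Ring as RingProperties
import Relation.Binary.Reasoning.Setoid as SetoidReasoning

module Proportionality {c ℓ m ℓm : Level} (F : Field c ℓ)
    (V : Module (Field.commutativeRing F) m ℓm) where
  open Field F
  open Module V
  open ProjectiveSpace F V
  open SetoidReasoning ≈ᴹ-setoid

  _∝_ : Carrierᴹ → Carrierᴹ → Set (c ⊔ ℓm)
  u ∝ w = ∃ λ k → u ≈ᴹ k *ₗ w

  ∝-refl : ∀ u → u ∝ u
  ∝-refl u = 1# , ≈ᴹ-sym (*ₗ-identityˡ u)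

  ∝-trans : ∀ {u v w} → u ∝ v → v ∝ w → u ∝ w
  ∝-trans {u} {v} {w} (s , u≈sv) (t , v≈tw) = s * t , (begin
    u              ≈⟨ u≈sv ⟩
    s *ₗ v         ≈⟨ *ₗ-congˡ v≈tw ⟩
    s *ₗ (t *ₗ w)  ≈⟨ *ₗ-assoc s t w ⟨
    (s * t) *ₗ w   ∎)

  -- A multiple of a nonzero vector is a nonzero multiple, so it can be
  -- inverted: this uses that nonzero scalars are invertible.
  ∝-sym : ∀ {u w} → ¬ (u ≈ᴹ 0ᴹ) → u ∝ w → w ∝ u
  ∝-sym {u} {w} u≉0 (s , u≈sw) = s⁻¹ , ≈ᴹ-sym (begin
    s⁻¹ *ₗ u         ≈⟨ *ₗ-congˡ u≈sw ⟩
    s⁻¹ *ₗ (s *ₗ w)  ≈⟨ *ₗ-assoc s⁻¹ s w ⟨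
    (s⁻¹ * s) *ₗ w   ≈⟨ *ₗ-congʳ (trans (*-comm s⁻¹ s) ss⁻¹≈1) ⟩
    1# *ₗ w          ≈⟨ *ₗ-identityˡ w ⟩
    w                ∎)
    where
    s≉0 : ¬ (s ≈ 0#)
    s≉0 s≈0 = u≉0 (≈ᴹ-trans u≈sw (≈ᴹ-trans (*ₗ-congʳ s≈0) (*ₗ-zeroˡ w)))
    s⁻¹ : Carrier
    s⁻¹ = proj₁ (inverse s s≉0)
    ss⁻¹≈1 : s * s⁻¹ ≈ 1#
    ss⁻¹≈1 = proj₂ (inverse s s≉0)

  ≐-refl : ∀ p → p ≐ p
  ≐-refl p = ∝-refl (vec p)

  -- Symmetry of point equality, stated for the underlying vectors so that
  -- the second point need not be recoverable from p ≐ q.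
  ≐-sym : ∀ p {w} → vec p ∝ w → w ∝ vec p
  ≐-sym p = ∝-sym (proj₂ p)

  non-multiple-≉0 : ∀ {u w} → ¬ (u ∝ w) → ¬ (u ≈ᴹ 0ᴹ)
  non-multiple-≉0 {u} {w} u∝̸w u≈0 = u∝̸w (0# , ≈ᴹ-trans u≈0 (≈ᴹ-sym (*ₗ-zeroˡ w)))

  +-cancel-multiple : ∀ {v w} t → v ≈ᴹ t *ₗ w → v +ᴹ (- t) *ₗ w ≈ᴹ 0ᴹ
  +-cancel-multiple {v} {w} t v≈tw = begin
    v +ᴹ (- t) *ₗ w         ≈⟨ +ᴹ-congʳ v≈tw ⟩
    t *ₗ w +ᴹ (- t) *ₗ w    ≈⟨ *ₗ-distribʳ w t (- t) ⟨
    (t + - t) *ₗ w          ≈⟨ *ₗ-congʳ (-‿inverseʳ t) ⟩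
    0# *ₗ w                 ≈⟨ *ₗ-zeroˡ w ⟩
    0ᴹ                      ∎

  non-multiple-+ : ∀ {u v w} → ¬ (u ∝ w) → v ∝ w → ¬ ((u +ᴹ v) ∝ w)
  non-multiple-+ {u} {v} {w} u∝̸w (t , v≈tw) (k , u+v≈kw) = u∝̸w (k + - t , (begin
    u                               ≈⟨ +ᴹ-identityʳ u ⟨
    u +ᴹ 0ᴹ                         ≈⟨ +ᴹ-congˡ (+-cancel-multiple t v≈tw) ⟨
    u +ᴹ (v +ᴹ (- t) *ₗ w)          ≈⟨ +ᴹ-assoc u v ((- t) *ₗ w) ⟨
    (u +ᴹ v) +ᴹ (- t) *ₗ w          ≈⟨ +ᴹ-congʳ u+v≈kw ⟩
    k *ₗ w +ᴹ (- t) *ₗ w            ≈⟨ *ₗ-distribʳ w k (- t) ⟨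
    (k + - t) *ₗ w                  ∎))

module SesquilinearFacts {c ℓ m ℓm : Level} (F : Field c ℓ)
    (V : Module (Field.commutativeRing F) m ℓm)
    (ξ : Module.Carrierᴹ V → Module.Carrierᴹ V → Field.Carrier F)
    (isForm : ProjectiveSpace.IsReflexiveSesquilinear F V ξ) where
  open Field F
  open Module V
  open ProjectiveSpace F V
  open IsReflexiveSesquilinear isForm renaming (cong to ξ-cong)
  open Proportionality F V
  open RingProperties ring using (-‿distribˡ-*)
  open SetoidReasoning setoid

  -- Orthogonality only depends on the points: ξ(y,x) = 0 implies
  -- ξ(t y, s x) = 0.  This makes the relation y ∈ κ(x) well defined on P.
  orthogonal-∝ : ∀ {u v x y} → ξ y x ≈ 0# → u ∝ y → v ∝ x → ξ u v ≈ 0#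
  orthogonal-∝ {u} {v} {x} {y} ξyx≈0 (t , u≈ty) (s , v≈sx) = begin
    ξ u v                      ≈⟨ ξ-cong u≈ty v≈sx ⟩
    ξ (t *ₗ y) (s *ₗ x)        ≈⟨ *-left t y (s *ₗ x) ⟩
    t * ξ y (s *ₗ x)           ≈⟨ *-congˡ (*-right s y x) ⟩
    t * (σ s * ξ y x)          ≈⟨ *-congˡ (*-congˡ ξyx≈0) ⟩
    t * (σ s * 0#)             ≈⟨ *-congˡ (zeroʳ (σ s)) ⟩
    t * 0#                     ≈⟨ zeroʳ t ⟩
    0#                         ∎

  orthogonalise : ∀ {a} → ¬ (ξ a a ≈ 0#) → ∀ d →
                  ∃ λ k → ξ (d +ᴹ k *ₗ a) a ≈ 0#
  orthogonalise {a} ξaa≉0 d = - λ₀ , (begin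
    ξ (d +ᴹ (- λ₀) *ₗ a) a      ≈⟨ +-left d ((- λ₀) *ₗ a) a ⟩
    ξ d a + ξ ((- λ₀) *ₗ a) a   ≈⟨ +-congˡ (*-left (- λ₀) a a) ⟩
    ξ d a + (- λ₀) * ξ a a      ≈⟨ +-congˡ (-‿distribˡ-* λ₀ (ξ a a)) ⟨
    ξ d a + - (λ₀ * ξ a a)      ≈⟨ +-congˡ (-‿cong λ₀α≈ξda) ⟩
    ξ d a + - ξ d a             ≈⟨ -‿inverseʳ (ξ d a) ⟩
    0#                          ∎)
    where
    α⁻¹ : Carrier
    α⁻¹ = proj₁ (inverse (ξ a a) ξaa≉0)
    λ₀ : Carrier
    λ₀ = ξ d a * α⁻¹
    λ₀α≈ξda : λ₀ * ξ a a ≈ ξ d a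
    λ₀α≈ξda = begin
      ξ d a * α⁻¹ * ξ a a     ≈⟨ *-assoc (ξ d a) α⁻¹ (ξ a a) ⟩
      ξ d a * (α⁻¹ * ξ a a)   ≈⟨ *-congˡ (trans (*-comm α⁻¹ (ξ a a)) (proj₂ (inverse (ξ a a) ξaa≉0))) ⟩
      ξ d a * 1#              ≈⟨ *-identityʳ (ξ d a) ⟩
      ξ d a                   ∎

  ξ-+-orthogonalˡ : ∀ {a b} → ξ b a ≈ 0# → ξ (b +ᴹ a) a ≈ ξ a a
  ξ-+-orthogonalˡ {a} {b} ξba≈0 =
    trans (+-left b a a) (trans (+-congʳ ξba≈0) (+-identityˡ (ξ a a)))

  ξ-+-orthogonalʳ : ∀ {a b} → ξ b a ≈ 0# → ξ a (b +ᴹ a) ≈ ξ a a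
  ξ-+-orthogonalʳ {a} {b} ξba≈0 =
    trans (+-right a b a) (trans (+-congʳ (reflexive-l b a ξba≈0)) (+-identityˡ (ξ a a)))

module VeroneseFacts {c ℓ m ℓm p : Level} (F : Field c ℓ)
    (V : Module (Field.commutativeRing F) m ℓm)
    (ξ : Module.Carrierᴹ V → Module.Carrierᴹ V → Field.Carrier F)
    (isForm : ProjectiveSpace.IsReflexiveSesquilinear F V ξ)
    (h₀ : ProjectiveSpace.Pt F V → Set p) where
  open Field F
  open Module V
  open ProjectiveSpace F V
  open Proportionality F V
  open SesquilinearFacts F V ξ isForm

  H : MPt → Set (c ⊔ ℓ ⊔ m ⊔ ℓm ⊔ p)
  H z = (∃ λ a → h₀ a × z ≐ₘ (a , a))
      ⊎ (∃ λ x → ∃ λ y → y ∈κ[ ξ ] x × z ≐ₘ (x , y))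

  non-conjugate-∉H : ∀ x y → ¬ (x ≐ y) → ¬ (y ∈κ[ ξ ] x) → ¬ (x ∈κ[ ξ ] y) →
                     ¬ H (x , y)
  non-conjugate-∉H _ y x≠y _ _ (inj₁ (a , _ , inj₁ (x≐a , y≐a))) = x≠y (∝-trans x≐a (≐-sym y y≐a))
  non-conjugate-∉H _ y x≠y _ _ (inj₁ (a , _ , inj₂ (x≐a , y≐a))) = x≠y (∝-trans x≐a (≐-sym y y≐a))
  non-conjugate-∉H _ _ _ y∉κx _ (inj₂ (x' , y' , y'∈κx' , inj₁ (x≐x' , y≐y'))) =
    y∉κx (orthogonal-∝ y'∈κx' y≐y' x≐x')
  non-conjugate-∉H _ _ _ _ x∉κy (inj₂ (x' , y' , y'∈κx' , inj₂ (x≐y' , y≐x'))) =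
    x∉κy (orthogonal-∝ y'∈κx' x≐y' y≐x')

  on-x+L : ∀ x (L : PLine) r → r ∈P L → (x , r) ∈V inj₁ (x , L)
  on-x+L x L r r∈L = r , r∈L , inj₁ (≐-refl x , ≐-refl r)

  first-∈P : ∀ (L : PLine) → proj₁ (proj₁ L) ∈P L
  first-∈P ((p , q) , _) = 1# , 0# , ≈ᴹ-sym (≈ᴹ-trans
    (+ᴹ-cong (*ₗ-identityˡ (vec p)) (*ₗ-zeroˡ (vec q))) (+ᴹ-identityʳ (vec p)))

  second-∈P : ∀ (L : PLine) → proj₂ (proj₁ L) ∈P L
  second-∈P ((p , q) , _) = 0# , 1# , ≈ᴹ-sym (≈ᴹ-trans
    (+ᴹ-cong (*ₗ-zeroˡ (vec p)) (*ₗ-identityˡ (vec q))) (+ᴹ-identityˡ (vec q)))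

  sum-∈P : ∀ (L : PLine) r → vec r ≈ᴹ vec (proj₁ (proj₁ L)) +ᴹ vec (proj₂ (proj₁ L)) →
           r ∈P L
  sum-∈P ((p , q) , _) r r≈p+q = 1# , 1# , ≈ᴹ-trans r≈p+q
    (≈ᴹ-sym (+ᴹ-cong (*ₗ-identityˡ (vec p)) (*ₗ-identityˡ (vec q))))

module Configuration {c ℓ m ℓm p : Level} (F : Field c ℓ)
    (V : Module (Field.commutativeRing F) m ℓm)
    (ξ : Module.Carrierᴹ V → Module.Carrierᴹ V → Field.Carrier F)
    (isForm : ProjectiveSpace.IsReflexiveSesquilinear F V ξ)
    (h₀ : ProjectiveSpace.Pt F V → Set p)
    (a : ProjectiveSpace.Pt F V) (a∈h₀ : h₀ a)
    (a∉κa : ¬ ProjectiveSpace._∈κ[_]_ F V a ξ a)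
    (b : Module.Carrierᴹ V)
    (b∝̸a : ¬ Proportionality._∝_ F V b (ProjectiveSpace.vec F V a))
    (ξba≈0 : Field._≈_ F (ξ b (ProjectiveSpace.vec F V a)) (Field.0# F)) where
  open Field F
  open Module V
  open ProjectiveSpace F V
  open Proportionality F V
  open SesquilinearFacts F V ξ isForm
  open VeroneseFacts F V ξ isForm h₀

  bP : Pt
  bP = b , non-multiple-≉0 b∝̸a

  c∝̸a : ¬ ((b +ᴹ vec a) ∝ vec a)
  c∝̸a = non-multiple-+ b∝̸a (∝-refl (vec a))

  cP : Pt
  cP = b +ᴹ vec a , non-multiple-≉0 c∝̸a

  L : PLine
  L = (a , bP) , λ a≐b → b∝̸a (≐-sym a a≐b)

  -- On the Veronese line a + L the points 2a and a + b lie in H but a + c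
  -- does not.
  not-subspace : ¬ IsSubspace MPt _≐ₘ_ VLine _∈V_ H
  not-subspace isSubspace = a+c∉H (isSubspace (inj₁ (a , L)) (a , a) (a , bP)
      (on-x+L a L a (first-∈P L)) (on-x+L a L bP (second-∈P L)) 2a≠a+b
      (inj₁ (a , a∈h₀ , inj₁ (≐-refl a , ≐-refl a)))
      (inj₂ (a , bP , ξba≈0 , inj₁ (≐-refl a , ≐-refl bP)))
      (a , cP) (on-x+L a L cP (sum-∈P L cP (+ᴹ-comm b (vec a)))))
    where
    2a≠a+b : ¬ ((a , a) ≐ₘ (a , bP))
    2a≠a+b (inj₁ (_ , a≐b)) = b∝̸a (≐-sym a a≐b)
    2a≠a+b (inj₂ (a≐b , _)) = b∝̸a (≐-sym a a≐b)
    a+c∉H : ¬ H (a , cP)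
    a+c∉H = non-conjugate-∉H a cP (λ a≐c → c∝̸a (≐-sym a a≐c))
      (λ c∈κa → a∉κa (trans (sym (ξ-+-orthogonalˡ ξba≈0)) c∈κa))
      (λ a∈κc → a∉κa (trans (sym (ξ-+-orthogonalʳ ξba≈0)) a∈κc))

-- Proof of Lemma 2.3: take a ∈ h₀ with ξ(a,a) ≠ 0 and d ∉ h₀; d is not a
-- multiple of a since h₀ is closed under point equality, and neither is its
-- Gram–Schmidt correction b = d + k a, which is orthogonal to a.
lemma2p3 : ∀ {c ℓ m ℓm p : Level} (F : Field c ℓ) → CharNot2 F →
    (V : Module (Field.commutativeRing F) m ℓm) →
    (ξ : Module.Carrierᴹ V → Module.Carrierᴹ V → Field.Carrier F) →
    ProjectiveSpace.IsReflexiveSesquilinear F V ξ →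
    (h₀ : ProjectiveSpace.Pt F V → Set p) →
    Hyperplanes.IsHyperplane F V h₀ →
    (∃ λ a → h₀ a × ¬ ProjectiveSpace._∈κ[_]_ F V a ξ a) →
    ¬ IsSubspace (ProjectiveSpace.MPt F V) (ProjectiveSpace._≐ₘ_ F V)
        (ProjectiveSpace.VLine F V) (ProjectiveSpace._∈V_ F V)
        (λ z → (∃ λ a → h₀ a × ProjectiveSpace._≐ₘ_ F V z (a , a))
             ⊎ (∃ λ x → ∃ λ y → ProjectiveSpace._∈κ[_]_ F V y ξ x
                  × ProjectiveSpace._≐ₘ_ F V z (x , y)))
lemma2p3 F _ V ξ isForm h₀ isHyperplane (a , a∈h₀ , a∉κa) =
  Configuration.not-subspace F V ξ isForm h₀ a a∈h₀ a∉κa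
    (vec d +ᴹ k *ₗ vec a) b∝̸a ξba≈0
  where
  open Field F using (Carrier; _≈_; 0#)
  open Module V using (_+ᴹ_; _*ₗ_; ≈ᴹ-refl)
  open ProjectiveSpace F V using (Pt; vec)
  open Proportionality F V
  open Hyperplanes.IsHyperplane isHyperplane using (respects; proper)
  open SesquilinearFacts F V ξ isForm using (orthogonalise)
  d : Pt
  d = proj₁ proper
  d∝̸a : ¬ (vec d ∝ vec a)
  d∝̸a d∝a = proj₂ proper (respects a d (≐-sym d d∝a) a∈h₀)
  k : Carrier
  k = proj₁ (orthogonalise a∉κa (vec d))
  ξba≈0 : ξ (vec d +ᴹ k *ₗ vec a) (vec a) ≈ 0#
  ξba≈0 = proj₂ (orthogonalise a∉κa (vec d))
  b∝̸a : ¬ ((vec d +ᴹ k *ₗ vec a) ∝ vec a)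
  b∝̸a = non-multiple-+ d∝̸a (k , ≈ᴹ-refl)
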